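{- There exist absolute constants $c, c'>0$ such that for every $n\ge1$, every function $f:\{0,1\}^n\to\{0,1\}$, every distribution $\mu$ on $\{0,1\}^n$, every positive integer $k$, and every $0\le\delta,\varepsilon\le\frac1{40}$, \[ \mathrm{D}^{\mu^k}_{\delta,\varepsilon}(f^k) \ge c'\cdot k\cdot \mathrm{D}^{\mu}_{\frac13,\frac{c\varepsilon}{k}}(f). \]
   Context: For $f:\{0,1\}^n\to\{0,1\}$, $f^k:\{0,1\}^{nk}\to\{0,1\}^k$ is $f^k(x^{(1)},\dots,x^{(k)})=(f(x^{(1)}),\dots,f(x^{(k)}))$, and $\mu^k$ is the product distribution of $k$ independent copies of $\mu$. A deterministic query algorithm adaptively queries input bits and outputs either a value or the abort symbol $\bot$. For a function $g$ and a distribution $\nu$ on its inputs, $\mathrm{D}^\nu_{\delta,\varepsilon}(g)$ is the minimum worst-case number of queries of a deterministic algorithm $\mathcal{A}$ such that $\Pr_{x\sim\nu}[\mathcal{A}(x)=\bot]\le\delta$ and $\Pr_{x\sim\nu}[\mathcal{A}(x)\ne\bot \text{ and } \mathcal{A}(x)\neq g(x)]\le\varepsilon$.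
   Formalization: The distribution μ takes rational values, and the parameters δ and ε are rational. -}

module Defs where

open import Data.Bool using (Bool; true; false; if_then_else_; not)
open import Data.Nat using (ℕ; zero; suc)
open import Data.Fin using (Fin)
import Data.Fin as Fin
open import Data.Product using (_×_; _,_)
open import Data.Maybe using (Maybe; just; nothing)
open import Data.List using (List; []; _∷_; map; concatMap)
open import Data.Vec using (Vec; tabulate)
open import Data.Rational using (ℚ; 0ℚ; 1ℚ; _+_; _*_; _≤_)
open import Relation.Nullary using (does)
open import Relation.Binary using (DecidableEquality)
open import Relation.Binary.PropositionalEquality using (_≡_)

allTuples : {A : Set} → (k : ℕ) → List A → List (Fin k → A)
allTuples zero    as = (λ ()) ∷ []
allTuples (suc k) as =
  concatMap (λ a → map (λ t → λ { Fin.zero → a ; (Fin.suc i) → t i }) (allTuples k as)) as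

bits : List Bool
bits = false ∷ true ∷ []

Input : ℕ → Set
Input n = Fin n → Bool

allInputs : (n : ℕ) → List (Input n)
allInputs n = allTuples n bits

-- an input (x^(1),...,x^(k)) of f^k, i.e. an element of {0,1}^{nk}
-- arranged in k blocks of n bits
BlockInput : ℕ → ℕ → Set
BlockInput n k = Fin k → Input n

allBlockInputs : (n k : ℕ) → List (BlockInput n k)
allBlockInputs n k = allTuples k (allInputs n)

sumℚ : List ℚ → ℚ
sumℚ []       = 0ℚ
sumℚ (q ∷ qs) = q + sumℚ qs

prodFin : (k : ℕ) → (Fin k → ℚ) → ℚ
prodFin zero    g = 1ℚ
prodFin (suc k) g = g Fin.zero * prodFin k (λ i → g (Fin.suc i))

IsDistribution : {X : Set} → List X → (X → ℚ) → Set
IsDistribution {X} xs ν = ((x : X) → 0ℚ ≤ ν x) × (sumℚ (map ν xs) ≡ 1ℚ)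

Pr : {X : Set} → List X → (X → ℚ) → (X → Bool) → ℚ
Pr xs ν E = sumℚ (map (λ x → if E x then ν x else 0ℚ) xs)

productDist : {n : ℕ} → (k : ℕ) → (Input n → ℚ) → BlockInput n k → ℚ
productDist k μ x = prodFin k (λ i → μ (x i))

-- Deterministic query algorithms (decision trees)
-- over index set I (input = I → Bool) with outputs O; leaf nothing = ⊥

data QueryAlg (I O : Set) : Set where
  leaf  : Maybe O → QueryAlg I O
  query : I → QueryAlg I O → QueryAlg I O → QueryAlg I O

run : {I O : Set} → QueryAlg I O → (I → Bool) → Maybe O
run (leaf o)      x = o
run (query i t₀ t₁) x = if x i then run t₁ x else run t₀ x

queries : {I O : Set} → QueryAlg I O → (I → Bool) → ℕ
queries (leaf o)        x = zero
queries (query i t₀ t₁) x = suc (if x i then queries t₁ x else queries t₀ x)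

QueriesAtMost : {I O : Set} → QueryAlg I O → ℕ → Set
QueriesAtMost {I} A q = (x : I → Bool) → Data.Nat._≤_ (queries A x) q

aborts : {I O : Set} → QueryAlg I O → (I → Bool) → Bool
aborts A x with run A x
... | nothing = true
... | just _  = false

errs : {I O : Set} → DecidableEquality O → QueryAlg I O → (I → Bool) → O → Bool
errs _≟_ A x o with run A x
... | nothing = false
... | just o' = not (does (o' ≟ o))

Solves : {X I O : Set} → DecidableEquality O → List X → (X → I → Bool) →
         (X → O) → (X → ℚ) → ℚ → ℚ → QueryAlg I O → Set
Solves _≟_ xs enc g ν δ ε A =
  (Pr xs ν (λ x → aborts A (enc x)) ≤ δ) ×
  (Pr xs ν (λ x → errs _≟_ A (enc x) (g x)) ≤ ε)

encode : {n : ℕ} → Input n → Fin n → Bool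
encode x = x

encodeBlocks : {n k : ℕ} → BlockInput n k → Fin k × Fin n → Bool
encodeBlocks x (i , j) = x i j

power : {n : ℕ} → (k : ℕ) → (Input n → Bool) → BlockInput n k → Vec Bool k
power k f x = tabulate (λ i → f (x i))

module Submission where

-- Fix a coordinate i, blocks y for the other coordinates and a budget T = ⌊10q/k⌋. The
-- algorithm B_{i,y} runs A on y with block i replaced by its own input x: queries to other
-- blocks are answered from y, the first T queries to block i are forwarded to x (B_{i,y}
-- aborts on the next one), and the answer is coordinate i of A's output, provided that
-- output agrees with f^k(y) elsewhere. B_{i,y}(x) depends only on z = y[i ← x], and
-- resampling one block of z ∼ μ^k leaves μ^k unchanged, so summing over i and averaging
-- over y ∼ μ^k bounds
--   * the abort probabilities by k(δ + ε + 1/10): B_{i,y} aborts only if A aborts or errs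
--     on z, or queries block i more than T times, which happens for fewer than k/10
--     blocks because A makes at most q < k(T + 1)/10 queries;
--   * the error probabilities by ε: B_{i,y} errs only if A's output on z is wrong exactly
--     at coordinate i, which happens for at most one i.
-- By Markov's inequality some (i, y) has abort probability ≤ 1/3 and error ≤ 2ε/k.

open import Algebra.Bundles using (CommutativeRing; CommutativeMonoid)
import Algebra.Properties.CommutativeSemigroup as CommSemigroupProperties
import Algebra.Properties.Semiring.Sum as SemiringSum
open import Data.Bool using (Bool; true; false; not; _∨_; if_then_else_)
import Data.Bool.Properties as BoolP
open import Data.Fin as Fin using (Fin; zero; suc)
open import Data.Integer as ℤ using (+_)
import Data.Integer.Properties as ℤ
open import Data.List using (List; []; _∷_; map; concatMap; _++_)
open import Data.Maybe using (Maybe; just; nothing; is-nothing; _>>=_)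
open import Data.Nat as ℕ using (ℕ; zero; suc; NonZero)
import Data.Nat.Coprimality as Coprime
import Data.Nat.DivMod as ℕ
import Data.Nat.Properties as ℕ
open import Data.Product as Product using (Σ; ∃; _×_; _,_)
open import Data.Rational as ℚ using (ℚ; 0ℚ; 1ℚ; _+_; _*_; _/_; _≤_; _<_; mkℚ; toℚᵘ; 1/_)
import Data.Rational.Properties as ℚ
import Data.Rational.Unnormalised as ℚᵘ
import Data.Rational.Unnormalised.Properties as ℚᵘ
open import Data.Rational.Solver using (module +-*-Solver)
open import Data.Sum using (_⊎_; inj₁; inj₂)
open import Data.Vec using (Vec; []; _∷_; lookup; _[_]≔_)
import Data.Vec.Properties as VecP
open import Data.Vec.Functional using (updateAt) renaming (_∷_ to _◂_)
import Data.Vec.Functional.Properties as VecF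
open import Function using (_∘_; _$_; id; const)
open import Relation.Binary.Core using (_Preserves_⟶_)
open import Relation.Binary.Definitions using (DecidableEquality; tri<; tri≈; tri>)
open import Relation.Binary.PropositionalEquality hiding (J)
open import Relation.Nullary using (Dec; yes; no; does; contradiction)
open import Relation.Nullary.Decidable using (from-yes; dec-true)

open import Defs

open SemiringSum (CommutativeRing.semiring ℚ.+-*-commutativeRing)
  using (sum; sum-syntax; sum-cong-≗; ∑-distrib-+; *-distribˡ-sum; sum-replicate-zero)
open CommSemigroupProperties (CommutativeMonoid.commutativeSemigroup ℚ.+-0-commutativeMonoid)
  using () renaming (interchange to +-interchange)
open CommSemigroupProperties (CommutativeMonoid.commutativeSemigroup ℚ.*-1-commutativeMonoid)
  using () renaming (x∙yz≈y∙xz to x*[y*z]≡y*[x*z])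

private variable
  X Y I J O : Set

fromℕ : ℕ → ℚ
fromℕ m = + m / 1

fromℕ≡mkℚ : ∀ m → fromℕ m ≡ mkℚ (+ m) 0 (Coprime.sym (Coprime.1-coprimeTo m))
fromℕ≡mkℚ m = ℚ.normalize-coprime (Coprime.sym (Coprime.1-coprimeTo m))

fromℕ-suc : ∀ m → fromℕ (suc m) ≡ 1ℚ + fromℕ m
fromℕ-suc m = ℚ.toℚᵘ-injective (begin
  toℚᵘ (fromℕ (suc m))                ≡⟨ cong toℚᵘ (fromℕ≡mkℚ (suc m)) ⟩
  ℚᵘ.mkℚᵘ (+ suc m) 0                 ≈⟨ ℚᵘ.*≡* (cong (ℤ._* + 1) numerators) ⟩
  toℚᵘ 1ℚ ℚᵘ.+ ℚᵘ.mkℚᵘ (+ m) 0        ≡⟨ cong (toℚᵘ 1ℚ ℚᵘ.+_) (cong toℚᵘ (fromℕ≡mkℚ m)) ⟨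
  toℚᵘ 1ℚ ℚᵘ.+ toℚᵘ (fromℕ m)         ≈⟨ ℚ.toℚᵘ-homo-+ 1ℚ (fromℕ m) ⟨
  toℚᵘ (1ℚ + fromℕ m)                 ∎)
  where
  open ℚᵘ.≃-Reasoning
  numerators : + suc m ≡ (+ 1) ℤ.+ (+ m) ℤ.* (+ 1)
  numerators = cong (ℤ._+_ (+ 1)) (sym (ℤ.*-identityʳ (+ m)))

fromℕ-homo-+ : ∀ m n → fromℕ (m ℕ.+ n) ≡ fromℕ m + fromℕ n
fromℕ-homo-+ zero    n = sym (ℚ.+-identityˡ (fromℕ n))
fromℕ-homo-+ (suc m) n = begin
  fromℕ (suc (m ℕ.+ n))      ≡⟨ fromℕ-suc (m ℕ.+ n) ⟩
  1ℚ + fromℕ (m ℕ.+ n)       ≡⟨ cong (_+_ 1ℚ) (fromℕ-homo-+ m n) ⟩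
  1ℚ + (fromℕ m + fromℕ n)   ≡⟨ ℚ.+-assoc 1ℚ (fromℕ m) (fromℕ n) ⟨
  1ℚ + fromℕ m + fromℕ n     ≡⟨ cong (_+ fromℕ n) (fromℕ-suc m) ⟨
  fromℕ (suc m) + fromℕ n    ∎
  where open ≡-Reasoning

fromℕ-homo-* : ∀ m n → fromℕ (m ℕ.* n) ≡ fromℕ m * fromℕ n
fromℕ-homo-* zero    n = sym (ℚ.*-zeroˡ (fromℕ n))
fromℕ-homo-* (suc m) n = begin
  fromℕ (n ℕ.+ m ℕ.* n)              ≡⟨ fromℕ-homo-+ n (m ℕ.* n) ⟩
  fromℕ n + fromℕ (m ℕ.* n)          ≡⟨ cong₂ _+_ (ℚ.*-identityˡ (fromℕ n)) (sym (fromℕ-homo-* m n)) ⟨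
  1ℚ * fromℕ n + fromℕ m * fromℕ n   ≡⟨ ℚ.*-distribʳ-+ (fromℕ n) 1ℚ (fromℕ m) ⟨
  (1ℚ + fromℕ m) * fromℕ n           ≡⟨ cong (_* fromℕ n) (fromℕ-suc m) ⟨
  fromℕ (suc m) * fromℕ n            ∎
  where open ≡-Reasoning

fromℕ-nonNeg : ∀ m → 0ℚ ≤ fromℕ m
fromℕ-nonNeg m = ℚ.nonNegative⁻¹ (fromℕ m) {{ℚ.normalize-nonNeg m 1}}

fromℕ-pos : ∀ m .{{_ : NonZero m}} → 0ℚ < fromℕ m
fromℕ-pos m = ℚ.positive⁻¹ (fromℕ m) {{ℚ.normalize-pos m 1}}

fromℕ-mono-≤ : ∀ {m n} → m ℕ.≤ n → fromℕ m ≤ fromℕ n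
fromℕ-mono-≤ {m} m≤n with d , refl ← ℕ.m≤n⇒∃[o]m+o≡n m≤n = begin
  fromℕ m             ≡⟨ ℚ.+-identityʳ (fromℕ m) ⟨
  fromℕ m + 0ℚ        ≤⟨ ℚ.+-monoʳ-≤ (fromℕ m) (fromℕ-nonNeg d) ⟩
  fromℕ m + fromℕ d   ≡⟨ fromℕ-homo-+ m d ⟨
  fromℕ (m ℕ.+ d)     ∎
  where open ℚ.≤-Reasoning

fromℕ*1/n≡1 : ∀ n .{{_ : NonZero n}} → fromℕ n * (+ 1 / n) ≡ 1ℚ
fromℕ*1/n≡1 (suc n) = begin
  fromℕ (suc n) * (+ 1 / suc n)
    ≡⟨ cong₂ _*_ (fromℕ≡mkℚ (suc n)) (ℚ.normalize-coprime (Coprime.1-coprimeTo (suc n))) ⟩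
  p * 1/ p
    ≡⟨ ℚ.*-inverseʳ p ⟩
  1ℚ
    ∎
  where
  open ≡-Reasoning
  p : ℚ
  p = mkℚ (+ suc n) 0 (Coprime.sym (Coprime.1-coprimeTo (suc n)))

*-monoˡ-≤ : ∀ {r p q} → 0ℚ ≤ r → p ≤ q → r * p ≤ r * q
*-monoˡ-≤ {r} 0≤r = ℚ.*-monoˡ-≤-nonNeg r {{ℚ.nonNegative 0≤r}}

*-nonNeg : ∀ {a b} → 0ℚ ≤ a → 0ℚ ≤ b → 0ℚ ≤ a * b
*-nonNeg {a} {b} 0≤a 0≤b = subst (_≤ a * b) (ℚ.*-zeroʳ a) (*-monoˡ-≤ 0≤a 0≤b)

+-<⇒<⊎< : ∀ {a b c d} → a + b < c + d → a < c ⊎ b < d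
+-<⇒<⊎< {a} {b} {c} {d} a+b<c+d with a ℚ.<? c | b ℚ.<? d
... | yes a<c | _       = inj₁ a<c
... | no _    | yes b<d = inj₂ b<d
... | no a≮c  | no b≮d  =
  contradiction (ℚ.<-≤-trans a+b<c+d (ℚ.+-mono-≤ (ℚ.≮⇒≥ a≮c) (ℚ.≮⇒≥ b≮d))) (ℚ.<-irrefl refl)

+-nonNeg-≤0 : ∀ {a b} → 0ℚ ≤ a → 0ℚ ≤ b → a + b ≤ 0ℚ → a ≤ 0ℚ × b ≤ 0ℚ
+-nonNeg-≤0 {a} {b} 0≤a 0≤b a+b≤0 =
  ℚ.≤-trans (subst (_≤ a + b) (ℚ.+-identityʳ a) (ℚ.+-monoʳ-≤ a 0≤b)) a+b≤0 ,
  ℚ.≤-trans (subst (_≤ a + b) (ℚ.+-identityˡ b) (ℚ.+-monoˡ-≤ b 0≤a)) a+b≤0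

sum-mono-≤ : ∀ {k} {f g : Fin k → ℚ} → (∀ i → f i ≤ g i) → sum f ≤ sum g
sum-mono-≤ {zero}  f≤g = ℚ.≤-refl
sum-mono-≤ {suc k} f≤g = ℚ.+-mono-≤ (f≤g zero) (sum-mono-≤ (f≤g ∘ suc))

sum-nonNeg : ∀ {k} {f : Fin k → ℚ} → (∀ i → 0ℚ ≤ f i) → 0ℚ ≤ sum f
sum-nonNeg {k} {f} 0≤f = subst (_≤ sum f) (sum-replicate-zero k) (sum-mono-≤ {f = λ _ → 0ℚ} 0≤f)

sum-const : ∀ k c → ∑[ i < k ] c ≡ fromℕ k * c
sum-const zero    c = sym (ℚ.*-zeroˡ c)
sum-const (suc k) c = begin
  c + ∑[ i < k ] c        ≡⟨ cong₂ _+_ (ℚ.*-identityˡ c) (sym (sum-const k c)) ⟨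
  1ℚ * c + fromℕ k * c    ≡⟨ ℚ.*-distribʳ-+ c 1ℚ (fromℕ k) ⟨
  (1ℚ + fromℕ k) * c      ≡⟨ cong (_* c) (fromℕ-suc k) ⟨
  fromℕ (suc k) * c       ∎
  where open ≡-Reasoning

sum-<⇒∃-< : ∀ {k} (f g : Fin k → ℚ) → sum f < sum g → ∃ λ i → f i < g i
sum-<⇒∃-< {zero}  f g 0<0 = contradiction 0<0 (ℚ.<-irrefl refl)
sum-<⇒∃-< {suc k} f g ∑f<∑g with +-<⇒<⊎< ∑f<∑g
... | inj₁ f₀<g₀ = zero , f₀<g₀
... | inj₂ rest  = Product.map suc id (sum-<⇒∃-< (f ∘ suc) (g ∘ suc) rest)

sum-vanishing : ∀ {k} {f g : Fin k → ℚ} → (∀ i → 0ℚ ≤ f i) → (∀ i → f i ≤ 0ℚ → g i ≤ 0ℚ) →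
                sum f ≤ 0ℚ → sum g ≤ 0ℚ
sum-vanishing {zero}  _   _   _    = ℚ.≤-refl
sum-vanishing {suc k} 0≤f f→g ∑f≤0 =
  let f₀≤0 , rest≤0 = +-nonNeg-≤0 (0≤f zero) (sum-nonNeg (0≤f ∘ suc)) ∑f≤0
  in  ℚ.+-mono-≤ (f→g zero f₀≤0) (sum-vanishing (0≤f ∘ suc) (f→g ∘ suc) rest≤0)

∑ᴸ : List X → (X → ℚ) → ℚ
∑ᴸ xs f = sumℚ (map f xs)

infixl 10 ∑ᴸ
syntax ∑ᴸ xs (λ x → e) = ∑[ x ∈ xs ] e

∑ᴸ-cong : ∀ (xs : List X) {f g : X → ℚ} → (∀ x → f x ≡ g x) → ∑ᴸ xs f ≡ ∑ᴸ xs g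
∑ᴸ-cong []       f≗g = refl
∑ᴸ-cong (x ∷ xs) f≗g = cong₂ _+_ (f≗g x) (∑ᴸ-cong xs f≗g)

∑ᴸ-mono-≤ : ∀ (xs : List X) {f g : X → ℚ} → (∀ x → f x ≤ g x) → ∑ᴸ xs f ≤ ∑ᴸ xs g
∑ᴸ-mono-≤ []       f≤g = ℚ.≤-refl
∑ᴸ-mono-≤ (x ∷ xs) f≤g = ℚ.+-mono-≤ (f≤g x) (∑ᴸ-mono-≤ xs f≤g)

∑ᴸ-zero : ∀ (xs : List X) → ∑[ x ∈ xs ] 0ℚ ≡ 0ℚ
∑ᴸ-zero []       = refl
∑ᴸ-zero (x ∷ xs) = trans (ℚ.+-identityˡ _) (∑ᴸ-zero xs)

∑ᴸ-nonNeg : ∀ (xs : List X) {f : X → ℚ} → (∀ x → 0ℚ ≤ f x) → 0ℚ ≤ ∑ᴸ xs f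
∑ᴸ-nonNeg xs {f} 0≤f = subst (_≤ ∑ᴸ xs f) (∑ᴸ-zero xs) (∑ᴸ-mono-≤ xs 0≤f)

∑ᴸ-distrib-+ : ∀ (xs : List X) (f g : X → ℚ) → ∑[ x ∈ xs ] (f x + g x) ≡ ∑ᴸ xs f + ∑ᴸ xs g
∑ᴸ-distrib-+ []       f g = refl
∑ᴸ-distrib-+ (x ∷ xs) f g =
  trans (cong (_+_ (f x + g x)) (∑ᴸ-distrib-+ xs f g)) (+-interchange (f x) (g x) (∑ᴸ xs f) (∑ᴸ xs g))

*-distribˡ-∑ᴸ : ∀ c (xs : List X) (f : X → ℚ) → c * ∑ᴸ xs f ≡ ∑[ x ∈ xs ] (c * f x)
*-distribˡ-∑ᴸ c []       f = ℚ.*-zeroʳ c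
*-distribˡ-∑ᴸ c (x ∷ xs) f =
  trans (ℚ.*-distribˡ-+ c (f x) _) (cong (_+_ (c * f x)) (*-distribˡ-∑ᴸ c xs f))

*-distribʳ-∑ᴸ : ∀ c (xs : List X) (f : X → ℚ) → ∑ᴸ xs f * c ≡ ∑[ x ∈ xs ] (f x * c)
*-distribʳ-∑ᴸ c xs f = begin
  ∑ᴸ xs f * c             ≡⟨ ℚ.*-comm _ c ⟩
  c * ∑ᴸ xs f             ≡⟨ *-distribˡ-∑ᴸ c xs f ⟩
  ∑[ x ∈ xs ] (c * f x)   ≡⟨ ∑ᴸ-cong xs (λ x → ℚ.*-comm c (f x)) ⟩
  ∑[ x ∈ xs ] (f x * c)   ∎
  where open ≡-Reasoning

∑ᴸ-++ : ∀ (xs ys : List X) (f : X → ℚ) → ∑ᴸ (xs ++ ys) f ≡ ∑ᴸ xs f + ∑ᴸ ys f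
∑ᴸ-++ []       ys f = sym (ℚ.+-identityˡ _)
∑ᴸ-++ (x ∷ xs) ys f = trans (cong (_+_ (f x)) (∑ᴸ-++ xs ys f)) (sym (ℚ.+-assoc (f x) _ _))

∑ᴸ-concatMap : ∀ (xs : List X) (g : X → List Y) (f : Y → ℚ) →
               ∑ᴸ (concatMap g xs) f ≡ ∑[ x ∈ xs ] ∑ᴸ (g x) f
∑ᴸ-concatMap []       g f = refl
∑ᴸ-concatMap (x ∷ xs) g f =
  trans (∑ᴸ-++ (g x) (concatMap g xs) f) (cong (_+_ (∑ᴸ (g x) f)) (∑ᴸ-concatMap xs g f))

∑ᴸ-map : ∀ (xs : List X) (g : X → Y) (f : Y → ℚ) → ∑ᴸ (map g xs) f ≡ ∑[ x ∈ xs ] f (g x)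
∑ᴸ-map []       g f = refl
∑ᴸ-map (x ∷ xs) g f = cong (_+_ (f (g x))) (∑ᴸ-map xs g f)

∑ᴸ-comm : ∀ (xs : List X) (ys : List Y) (f : X → Y → ℚ) →
          ∑[ x ∈ xs ] ∑[ y ∈ ys ] f x y ≡ ∑[ y ∈ ys ] ∑[ x ∈ xs ] f x y
∑ᴸ-comm []       ys f = sym (∑ᴸ-zero ys)
∑ᴸ-comm (x ∷ xs) ys f =
  trans (cong (_+_ (∑ᴸ ys (f x))) (∑ᴸ-comm xs ys f)) (sym (∑ᴸ-distrib-+ ys (f x) _))

∑ᴸ-sum-comm : ∀ {k} (xs : List X) (f : Fin k → X → ℚ) →
              ∑[ x ∈ xs ] ∑[ i < k ] f i x ≡ ∑[ i < k ] ∑[ x ∈ xs ] f i x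
∑ᴸ-sum-comm {k = k} []       f = sym (sum-replicate-zero k)
∑ᴸ-sum-comm {k = k} (x ∷ xs) f =
  trans (cong (_+_ (∑[ i < k ] f i x)) (∑ᴸ-sum-comm xs f)) (sym (∑-distrib-+ (λ i → f i x) _))

∑ᴸ-<⇒∃-< : ∀ (xs : List X) (f g : X → ℚ) → ∑ᴸ xs f < ∑ᴸ xs g → ∃ λ x → f x < g x
∑ᴸ-<⇒∃-< []       f g 0<0 = contradiction 0<0 (ℚ.<-irrefl refl)
∑ᴸ-<⇒∃-< (x ∷ xs) f g ∑f<∑g with +-<⇒<⊎< ∑f<∑g
... | inj₁ fx<gx = x , fx<gx
... | inj₂ rest  = ∑ᴸ-<⇒∃-< xs f g rest

∑ᴸ-vanishing : ∀ (xs : List X) {f g : X → ℚ} → (∀ x → 0ℚ ≤ f x) →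
               (∀ x → f x ≤ 0ℚ → g x ≤ 0ℚ) → ∑ᴸ xs f ≤ 0ℚ → ∑ᴸ xs g ≤ 0ℚ
∑ᴸ-vanishing []       _   _   _    = ℚ.≤-refl
∑ᴸ-vanishing (x ∷ xs) 0≤f f→g ∑f≤0 =
  let fx≤0 , rest≤0 = +-nonNeg-≤0 (0≤f x) (∑ᴸ-nonNeg xs 0≤f) ∑f≤0
  in  ℚ.+-mono-≤ (f→g x fx≤0) (∑ᴸ-vanishing xs 0≤f f→g rest≤0)

𝟙 : Bool → ℚ
𝟙 true  = 1ℚ
𝟙 false = 0ℚ

𝟙-nonNeg : ∀ b → 0ℚ ≤ 𝟙 b
𝟙-nonNeg true  = ℚ.≤ᵇ⇒≤ _
𝟙-nonNeg false = ℚ.≤-refl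

𝟙-≤1 : ∀ b → 𝟙 b ≤ 1ℚ
𝟙-≤1 true  = ℚ.≤-refl
𝟙-≤1 false = ℚ.≤ᵇ⇒≤ _

𝟙-∨ : ∀ a b → 𝟙 (a ∨ b) ≤ 𝟙 a + 𝟙 b
𝟙-∨ true  b = subst (_≤ 1ℚ + 𝟙 b) (ℚ.+-identityʳ 1ℚ) (ℚ.+-monoʳ-≤ 1ℚ (𝟙-nonNeg b))
𝟙-∨ false b = ℚ.≤-reflexive (sym (ℚ.+-identityˡ (𝟙 b)))

_>ᵇ_ : ℚ → ℚ → Bool
p >ᵇ t = not (does (p ℚ.≤? t))

Pr≡∑ : ∀ (xs : List X) ν E → Pr xs ν E ≡ ∑[ x ∈ xs ] (ν x * 𝟙 (E x))
Pr≡∑ xs ν E = ∑ᴸ-cong xs λ x → if-then-0 (E x) (ν x)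
  where
  if-then-0 : ∀ b p → (if b then p else 0ℚ) ≡ p * 𝟙 b
  if-then-0 true  p = sym (ℚ.*-identityʳ p)
  if-then-0 false p = sym (ℚ.*-zeroʳ p)

Pr-nonNeg : ∀ (xs : List X) {ν} → (∀ x → 0ℚ ≤ ν x) → ∀ E → 0ℚ ≤ Pr xs ν E
Pr-nonNeg xs {ν} 0≤ν E =
  subst (0ℚ ≤_) (sym (Pr≡∑ xs ν E)) (∑ᴸ-nonNeg xs λ x → *-nonNeg (0≤ν x) (𝟙-nonNeg (E x)))

Pr-∨ : ∀ (xs : List X) {ν} → (∀ x → 0ℚ ≤ ν x) → ∀ E F →
       Pr xs ν (λ x → E x ∨ F x) ≤ Pr xs ν E + Pr xs ν F
Pr-∨ xs {ν} 0≤ν E F = begin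
  Pr xs ν (λ x → E x ∨ F x)
    ≡⟨ Pr≡∑ xs ν _ ⟩
  ∑[ x ∈ xs ] (ν x * 𝟙 (E x ∨ F x))
    ≤⟨ ∑ᴸ-mono-≤ xs (λ x → *-monoˡ-≤ (0≤ν x) (𝟙-∨ (E x) (F x))) ⟩
  ∑[ x ∈ xs ] (ν x * (𝟙 (E x) + 𝟙 (F x)))
    ≡⟨ ∑ᴸ-cong xs (λ x → ℚ.*-distribˡ-+ (ν x) (𝟙 (E x)) (𝟙 (F x))) ⟩
  ∑[ x ∈ xs ] (ν x * 𝟙 (E x) + ν x * 𝟙 (F x))
    ≡⟨ ∑ᴸ-distrib-+ xs _ _ ⟩
  ∑[ x ∈ xs ] (ν x * 𝟙 (E x)) + ∑[ x ∈ xs ] (ν x * 𝟙 (F x))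
    ≡⟨ cong₂ _+_ (Pr≡∑ xs ν E) (Pr≡∑ xs ν F) ⟨
  Pr xs ν E + Pr xs ν F
    ∎
  where open ℚ.≤-Reasoning

module Averaging {Y : Set} (Ys : List Y) (W : Y → ℚ) (0≤W : ∀ y → 0ℚ ≤ W y) (k : ℕ) where

  total : (Fin k → Y → ℚ) → ℚ
  total g = ∑[ i < k ] ∑[ y ∈ Ys ] (W y * g i y)

  total-mono-≤ : ∀ {g h} → (∀ i y → g i y ≤ h i y) → total g ≤ total h
  total-mono-≤ g≤h = sum-mono-≤ λ i → ∑ᴸ-mono-≤ Ys λ y → *-monoˡ-≤ (0≤W y) (g≤h i y)

  total-+ : ∀ g h → total (λ i y → g i y + h i y) ≡ total g + total h
  total-+ g h = begin
    ∑[ i < k ] ∑[ y ∈ Ys ] (W y * (g i y + h i y))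
      ≡⟨ sum-cong-≗ (λ i → ∑ᴸ-cong Ys λ y → ℚ.*-distribˡ-+ (W y) (g i y) (h i y)) ⟩
    ∑[ i < k ] ∑[ y ∈ Ys ] (W y * g i y + W y * h i y)
      ≡⟨ sum-cong-≗ (λ i → ∑ᴸ-distrib-+ Ys (λ y → W y * g i y) (λ y → W y * h i y)) ⟩
    ∑[ i < k ] (∑[ y ∈ Ys ] (W y * g i y) + ∑[ y ∈ Ys ] (W y * h i y))
      ≡⟨ ∑-distrib-+ (λ i → ∑[ y ∈ Ys ] (W y * g i y)) (λ i → ∑[ y ∈ Ys ] (W y * h i y)) ⟩
    total g + total h
      ∎
    where open ≡-Reasoning

  total-*ˡ : ∀ c g → total (λ i y → c * g i y) ≡ c * total g
  total-*ˡ c g = begin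
    ∑[ i < k ] ∑[ y ∈ Ys ] (W y * (c * g i y))
      ≡⟨ sum-cong-≗ (λ i → ∑ᴸ-cong Ys λ y → x*[y*z]≡y*[x*z] (W y) c (g i y)) ⟩
    ∑[ i < k ] ∑[ y ∈ Ys ] (c * (W y * g i y))
      ≡⟨ sum-cong-≗ (λ i → *-distribˡ-∑ᴸ c Ys (λ y → W y * g i y)) ⟨
    ∑[ i < k ] (c * ∑[ y ∈ Ys ] (W y * g i y))
      ≡⟨ *-distribˡ-sum c (λ i → ∑[ y ∈ Ys ] (W y * g i y)) ⟨
    c * total g
      ∎
    where open ≡-Reasoning

  total-const : ∑ᴸ Ys W ≡ 1ℚ → ∀ c → total (λ _ _ → c) ≡ fromℕ k * c
  total-const ∑W≡1 c = begin
    ∑[ i < k ] ∑[ y ∈ Ys ] (W y * c)   ≡⟨ sum-cong-≗ {k} (λ i → *-distribʳ-∑ᴸ c Ys W) ⟨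
    ∑[ i < k ] (∑ᴸ Ys W * c)           ≡⟨ sum-cong-≗ {k} (λ i → ∑W*c≡c) ⟩
    ∑[ i < k ] c                       ≡⟨ sum-const k c ⟩
    fromℕ k * c                        ∎
    where
    open ≡-Reasoning
    ∑W*c≡c : ∑ᴸ Ys W * c ≡ c
    ∑W*c≡c = trans (cong (_* c) ∑W≡1) (ℚ.*-identityˡ c)

  total-<⇒∃-< : ∀ g h → total g < total h → ∃ λ i → ∃ λ y → W y * g i y < W y * h i y
  total-<⇒∃-< g h ∑g<∑h =
    let i , ∑gᵢ<∑hᵢ = sum-<⇒∃-< (λ i → ∑[ y ∈ Ys ] (W y * g i y)) (λ i → ∑[ y ∈ Ys ] (W y * h i y))
                                ∑g<∑h
    in  i , ∑ᴸ-<⇒∃-< Ys (λ y → W y * g i y) (λ y → W y * h i y) ∑gᵢ<∑hᵢ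

  total-vanishing : ∀ {g h} → (∀ i y → 0ℚ ≤ g i y) →
                    (∀ i y → W y * g i y ≤ 0ℚ → W y * h i y ≤ 0ℚ) → total g ≤ 0ℚ → total h ≤ 0ℚ
  total-vanishing 0≤g g→h = sum-vanishing
    (λ i → ∑ᴸ-nonNeg Ys λ y → *-nonNeg (0≤W y) (0≤g i y))
    (λ i → ∑ᴸ-vanishing Ys (λ y → *-nonNeg (0≤W y) (0≤g i y)) (g→h i))

  -- For t = 0 Markov's inequality cannot be divided by t; instead total g = 0 makes every
  -- point with g > 0 weightless.
  markov : ∀ {g} t c → 0ℚ ≤ t → 0ℚ ≤ c → (∀ i y → 0ℚ ≤ g i y) → total g ≤ t * c →
           total (λ i y → 𝟙 (g i y >ᵇ t)) ≤ c
  markov {g} t c 0≤t 0≤c 0≤g ∑g≤tc with ℚ.<-cmp 0ℚ t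
  ... | tri< 0<t _ _ = ℚ.*-cancelˡ-≤-pos t {{ℚ.positive 0<t}} (begin
    t * total exceeds                 ≡⟨ total-*ˡ t exceeds ⟨
    total (λ i y → t * exceeds i y)   ≤⟨ total-mono-≤ (λ i y → t*𝟙≤ (0≤g i y) (g i y ℚ.≤? t)) ⟩
    total g                           ≤⟨ ∑g≤tc ⟩
    t * c                             ∎)
    where
    open ℚ.≤-Reasoning
    exceeds : Fin k → Y → ℚ
    exceeds i y = 𝟙 (g i y >ᵇ t)
    t*𝟙≤ : ∀ {a} → 0ℚ ≤ a → (a≤?t : Dec (a ≤ t)) → t * 𝟙 (not (does a≤?t)) ≤ a
    t*𝟙≤ {a} 0≤a (yes _)  = subst (_≤ a) (sym (ℚ.*-zeroʳ t)) 0≤a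
    t*𝟙≤ {a} _   (no a≰t) = subst (_≤ a) (sym (ℚ.*-identityʳ t)) (ℚ.<⇒≤ (ℚ.≰⇒> a≰t))
  ... | tri≈ _ refl _ =
    ℚ.≤-trans (total-vanishing 0≤g (λ i y → w*𝟙≤0 {W y} (g i y ℚ.≤? 0ℚ)) ∑g≤0) 0≤c
    where
    ∑g≤0 : total g ≤ 0ℚ
    ∑g≤0 = ℚ.≤-trans ∑g≤tc (ℚ.≤-reflexive (ℚ.*-zeroˡ c))
    w*𝟙≤0 : ∀ {w a} (a≤?0 : Dec (a ≤ 0ℚ)) → w * a ≤ 0ℚ → w * 𝟙 (not (does a≤?0)) ≤ 0ℚ
    w*𝟙≤0 {w}     (yes _)  _    = ℚ.≤-reflexive (ℚ.*-zeroʳ w)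
    w*𝟙≤0 {w} {a} (no a≰0) wa≤0 = subst (_≤ 0ℚ) (sym (ℚ.*-identityʳ w))
      (ℚ.*-cancelʳ-≤-pos a {{ℚ.positive (ℚ.≰⇒> a≰0)}}
        (ℚ.≤-trans wa≤0 (ℚ.≤-reflexive (sym (ℚ.*-zeroˡ a)))))
  ... | tri> _ _ t<0 = contradiction (ℚ.<-≤-trans t<0 0≤t) (ℚ.<-irrefl refl)

  averaging : ∑ᴸ Ys W ≡ 1ℚ → .{{_ : NonZero k}} → ∀ {α β : Fin k → Y → ℚ} {ε} →
              (∀ i y → 0ℚ ≤ α i y) → (∀ i y → 0ℚ ≤ β i y) → 0ℚ ≤ ε →
              total α ≤ fromℕ k * (+ 3 / 20) → total β ≤ ε →
              ∃ λ i → ∃ λ y → α i y ≤ + 1 / 3 × β i y ≤ + 2 / 1 * ε * (+ 1 / k)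
  averaging ∑W≡1 {α} {β} {ε} 0≤α 0≤β 0≤ε ∑α≤ ∑β≤ =
    let i , y , w*bad<w = total-<⇒∃-< bad (λ _ _ → 1ℚ) bad-rare
    in  i , y , good {W y} (α i y ℚ.≤? ⅓) (β i y ℚ.≤? t) w*bad<w
    where
    open +-*-Solver
    ⅓ ½ t K : ℚ
    ⅓ = + 1 / 3
    ½ = + 1 / 2
    t = + 2 / 1 * ε * (+ 1 / k)
    K = fromℕ k

    bad : Fin k → Y → ℚ
    bad i y = 𝟙 (α i y >ᵇ ⅓ ∨ β i y >ᵇ t)

    α-rare : total (λ i y → 𝟙 (α i y >ᵇ ⅓)) ≤ K * (+ 9 / 20)
    α-rare = markov ⅓ (K * (+ 9 / 20)) (from-yes (0ℚ ℚ.≤? ⅓))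
      (*-nonNeg (fromℕ-nonNeg k) (from-yes (0ℚ ℚ.≤? (+ 9 / 20)))) 0≤α
      (ℚ.≤-trans ∑α≤ (ℚ.≤-reflexive (sym (x*[y*z]≡y*[x*z] ⅓ K (+ 9 / 20)))))

    β-rare : total (λ i y → 𝟙 (β i y >ᵇ t)) ≤ K * ½
    β-rare = markov t (K * ½) 0≤t (*-nonNeg (fromℕ-nonNeg k) (from-yes (0ℚ ℚ.≤? ½))) 0≤β
      (ℚ.≤-trans ∑β≤ (ℚ.≤-reflexive (sym t*K½≡ε)))
      where
      0≤t : 0ℚ ≤ t
      0≤t = *-nonNeg (*-nonNeg (from-yes (0ℚ ℚ.≤? (+ 2 / 1))) 0≤ε)
                     (ℚ.nonNegative⁻¹ (+ 1 / k) {{ℚ.normalize-nonNeg 1 k}})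
      t*K½≡ε : t * (K * ½) ≡ ε
      t*K½≡ε = begin
        + 2 / 1 * ε * (+ 1 / k) * (K * ½)
          ≡⟨ solve 5 (λ two e i κ h → two :* e :* i :* (κ :* h) := (two :* h) :* (e :* (κ :* i)))
                   refl (+ 2 / 1) ε (+ 1 / k) K ½ ⟩
        (+ 2 / 1 * ½) * (ε * (K * (+ 1 / k)))
          ≡⟨ cong (λ x → 1ℚ * (ε * x)) (fromℕ*1/n≡1 k) ⟩
        1ℚ * (ε * 1ℚ)
          ≡⟨ trans (ℚ.*-identityˡ _) (ℚ.*-identityʳ ε) ⟩
        ε
          ∎
        where open ≡-Reasoning

    bad-rare : total bad < total (λ _ _ → 1ℚ)
    bad-rare = begin-strict
      total bad
        ≤⟨ total-mono-≤ (λ i y → 𝟙-∨ (α i y >ᵇ ⅓) (β i y >ᵇ t)) ⟩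
      total (λ i y → 𝟙 (α i y >ᵇ ⅓) + 𝟙 (β i y >ᵇ t))
        ≡⟨ total-+ (λ i y → 𝟙 (α i y >ᵇ ⅓)) (λ i y → 𝟙 (β i y >ᵇ t)) ⟩
      total (λ i y → 𝟙 (α i y >ᵇ ⅓)) + total (λ i y → 𝟙 (β i y >ᵇ t))
        ≤⟨ ℚ.+-mono-≤ α-rare β-rare ⟩
      K * (+ 9 / 20) + K * ½
        ≡⟨ ℚ.*-distribˡ-+ K (+ 9 / 20) ½ ⟨
      K * (+ 19 / 20)
        <⟨ ℚ.*-monoʳ-<-pos K {{ℚ.positive (fromℕ-pos k)}} (from-yes (+ 19 / 20 ℚ.<? 1ℚ)) ⟩
      K * 1ℚ
        ≡⟨ total-const ∑W≡1 1ℚ ⟨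
      total (λ _ _ → 1ℚ)
        ∎
      where open ℚ.≤-Reasoning

    good : ∀ {w a b} (a≤?⅓ : Dec (a ≤ ⅓)) (b≤?t : Dec (b ≤ t)) →
           w * 𝟙 (not (does a≤?⅓) ∨ not (does b≤?t)) < w * 1ℚ → a ≤ ⅓ × b ≤ t
    good (yes a≤⅓) (yes b≤t) _   = a≤⅓ , b≤t
    good (no _)    _         w<w = contradiction w<w (ℚ.<-irrefl refl)
    good (yes _)   (no _)    w<w = contradiction w<w (ℚ.<-irrefl refl)

-- Product distributions

prodFin-cong : ∀ k {f g : Fin k → ℚ} → (∀ i → f i ≡ g i) → prodFin k f ≡ prodFin k g
prodFin-cong zero    f≗g = refl
prodFin-cong (suc k) f≗g = cong₂ _*_ (f≗g zero) (prodFin-cong k (f≗g ∘ suc))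

-- allTuples builds its tuples with a pattern lambda that agrees with a ◂ t only pointwise,
-- so sums over tuples need summands respecting _≗_.
∑ᴸ-allTuples-suc : ∀ {A : Set} k (as : List A) (h : (Fin (suc k) → A) → ℚ) → h Preserves _≗_ ⟶ _≡_ →
                   ∑ᴸ (allTuples (suc k) as) h ≡ ∑[ a ∈ as ] ∑[ t ∈ allTuples k as ] h (a ◂ t)
∑ᴸ-allTuples-suc k as h h-cong = trans (∑ᴸ-concatMap as _ h) (∑ᴸ-cong as λ a →
  trans (∑ᴸ-map (allTuples k as) _ h)
        (∑ᴸ-cong (allTuples k as) λ t → h-cong λ { zero → refl ; (suc _) → refl }))

_[_]←_ : ∀ {A : Set} {k} → (Fin k → A) → Fin k → A → Fin k → A
y [ i ]← x = updateAt y i (const x)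

[]←-cong : ∀ {A : Set} {k} (i : Fin k) (x : A) {y y′ : Fin k → A} → y ≗ y′ → y [ i ]← x ≗ y′ [ i ]← x
[]←-cong zero    x y≗y′ zero    = refl
[]←-cong zero    x y≗y′ (suc j) = y≗y′ (suc j)
[]←-cong (suc i) x y≗y′ zero    = y≗y′ zero
[]←-cong (suc i) x y≗y′ (suc j) = []←-cong i x (y≗y′ ∘ suc) j

module ProductDistribution {n} (μ : Input n → ℚ) (∑μ≡1 : ∑ᴸ (allInputs n) μ ≡ 1ℚ) where

  private
    Xs : List (Input n)
    Xs = allInputs n
    Zs : ∀ k → List (BlockInput n k)
    Zs = allBlockInputs n

  W : ∀ {k} → BlockInput n k → ℚ
  W {k} = productDist k μ

  W-cong : ∀ {k} → W {k} Preserves _≗_ ⟶ _≡_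
  W-cong {k} z≗z′ = prodFin-cong k (cong μ ∘ z≗z′)

  W-nonNeg : (∀ x → 0ℚ ≤ μ x) → ∀ {k} (z : BlockInput n k) → 0ℚ ≤ W z
  W-nonNeg 0≤μ {zero}  z = ℚ.≤ᵇ⇒≤ _
  W-nonNeg 0≤μ {suc k} z = *-nonNeg (0≤μ (z zero)) (W-nonNeg 0≤μ (z ∘ suc))

  ∑W-suc : ∀ k (h : BlockInput n (suc k) → ℚ) → h Preserves _≗_ ⟶ _≡_ →
           ∑[ z ∈ Zs (suc k) ] (W z * h z) ≡ ∑[ a ∈ Xs ] (μ a * ∑[ t ∈ Zs k ] (W t * h (a ◂ t)))
  ∑W-suc k h h-cong = begin
    ∑[ z ∈ Zs (suc k) ] (W z * h z)
      ≡⟨ ∑ᴸ-allTuples-suc k Xs (λ z → W z * h z) (λ z≗z′ → cong₂ _*_ (W-cong z≗z′) (h-cong z≗z′)) ⟩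
    ∑[ a ∈ Xs ] ∑[ t ∈ Zs k ] (μ a * W t * h (a ◂ t))
      ≡⟨ ∑ᴸ-cong Xs (λ a → ∑ᴸ-cong (Zs k) λ t → ℚ.*-assoc (μ a) (W t) _) ⟩
    ∑[ a ∈ Xs ] ∑[ t ∈ Zs k ] (μ a * (W t * h (a ◂ t)))
      ≡⟨ ∑ᴸ-cong Xs (λ a → *-distribˡ-∑ᴸ (μ a) (Zs k) _) ⟨
    ∑[ a ∈ Xs ] (μ a * ∑[ t ∈ Zs k ] (W t * h (a ◂ t)))
      ∎
    where open ≡-Reasoning

  ∑W≡1 : ∀ k → ∑ᴸ (Zs k) W ≡ 1ℚ
  ∑W≡1 zero    = ℚ.+-identityʳ 1ℚ
  ∑W≡1 (suc k) = begin
    ∑ᴸ (Zs (suc k)) W                      ≡⟨ ∑ᴸ-allTuples-suc k Xs W W-cong ⟩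
    ∑[ a ∈ Xs ] ∑[ t ∈ Zs k ] (μ a * W t)  ≡⟨ ∑ᴸ-cong Xs (λ a → *-distribˡ-∑ᴸ (μ a) (Zs k) W) ⟨
    ∑[ a ∈ Xs ] (μ a * ∑ᴸ (Zs k) W)        ≡⟨ ∑ᴸ-cong Xs (λ a → μa*∑W≡μa a) ⟩
    ∑ᴸ Xs μ                                ≡⟨ ∑μ≡1 ⟩
    1ℚ                                     ∎
    where
    open ≡-Reasoning
    μa*∑W≡μa : ∀ a → μ a * ∑ᴸ (Zs k) W ≡ μ a
    μa*∑W≡μa a = trans (cong (μ a *_) (∑W≡1 k)) (ℚ.*-identityʳ (μ a))

  ∑W-affine : ∀ k K c (a : BlockInput n k → ℚ) →
              ∑[ z ∈ Zs k ] (W z * (K * (a z + c))) ≡ K * (∑[ z ∈ Zs k ] (W z * a z) + c)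
  ∑W-affine k K c a = begin
    ∑[ z ∈ Zs k ] (W z * (K * (a z + c)))
      ≡⟨ ∑ᴸ-cong (Zs k) (λ z → x*[y*z]≡y*[x*z] (W z) K (a z + c)) ⟩
    ∑[ z ∈ Zs k ] (K * (W z * (a z + c)))
      ≡⟨ *-distribˡ-∑ᴸ K (Zs k) (λ z → W z * (a z + c)) ⟨
    K * ∑[ z ∈ Zs k ] (W z * (a z + c))
      ≡⟨ cong (K *_) (∑ᴸ-cong (Zs k) (λ z → ℚ.*-distribˡ-+ (W z) (a z) c)) ⟩
    K * ∑[ z ∈ Zs k ] (W z * a z + W z * c)
      ≡⟨ cong (K *_) (∑ᴸ-distrib-+ (Zs k) (λ z → W z * a z) (λ z → W z * c)) ⟩
    K * (∑[ z ∈ Zs k ] (W z * a z) + ∑[ z ∈ Zs k ] (W z * c))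
      ≡⟨ cong (λ s → K * (∑[ z ∈ Zs k ] (W z * a z) + s)) ∑Wc≡c ⟩
    K * (∑[ z ∈ Zs k ] (W z * a z) + c)
      ∎
    where
    open ≡-Reasoning
    ∑Wc≡c : ∑[ z ∈ Zs k ] (W z * c) ≡ c
    ∑Wc≡c = trans (sym (*-distribʳ-∑ᴸ c (Zs k) W)) (trans (cong (_* c) (∑W≡1 k)) (ℚ.*-identityˡ c))

  resampled-cong : ∀ {k} (i : Fin k) (g : BlockInput n k → ℚ) → g Preserves _≗_ ⟶ _≡_ →
                   (λ y → ∑[ x ∈ Xs ] (μ x * g (y [ i ]← x))) Preserves _≗_ ⟶ _≡_
  resampled-cong i g g-cong y≗y′ = ∑ᴸ-cong Xs λ x → cong (μ x *_) (g-cong ([]←-cong i x y≗y′))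

  resample : ∀ k (i : Fin k) (g : BlockInput n k → ℚ) → g Preserves _≗_ ⟶ _≡_ →
             ∑[ y ∈ Zs k ] (W y * ∑[ x ∈ Xs ] (μ x * g (y [ i ]← x))) ≡ ∑[ z ∈ Zs k ] (W z * g z)
  resample (suc k) zero g g-cong = begin
    ∑[ y ∈ Zs (suc k) ] (W y * ∑[ x ∈ Xs ] (μ x * g (y [ zero ]← x)))
      ≡⟨ ∑W-suc k _ (resampled-cong zero g g-cong) ⟩
    ∑[ a ∈ Xs ] (μ a * ∑[ t ∈ Zs k ] (W t * ∑[ x ∈ Xs ] (μ x * g ((a ◂ t) [ zero ]← x))))
      ≡⟨ ∑ᴸ-cong Xs (λ a → cong (μ a *_) (∑ᴸ-cong (Zs k) λ t → cong (W t *_) (∑ᴸ-cong Xs λ x →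
           cong (μ x *_) (g-cong λ { zero → refl ; (suc _) → refl })))) ⟩
    ∑[ a ∈ Xs ] (μ a * K)
      ≡⟨ *-distribʳ-∑ᴸ K Xs μ ⟨
    ∑ᴸ Xs μ * K
      ≡⟨ trans (cong (_* K) ∑μ≡1) (ℚ.*-identityˡ K) ⟩
    K
      ≡⟨ ∑ᴸ-cong (Zs k) (λ t → *-distribˡ-∑ᴸ (W t) Xs _) ⟩
    ∑[ t ∈ Zs k ] ∑[ x ∈ Xs ] (W t * (μ x * g (x ◂ t)))
      ≡⟨ ∑ᴸ-comm (Zs k) Xs _ ⟩
    ∑[ x ∈ Xs ] ∑[ t ∈ Zs k ] (W t * (μ x * g (x ◂ t)))
      ≡⟨ ∑ᴸ-cong Xs (λ x → ∑ᴸ-cong (Zs k) λ t → x*[y*z]≡y*[x*z] (W t) (μ x) _) ⟩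
    ∑[ x ∈ Xs ] ∑[ t ∈ Zs k ] (μ x * (W t * g (x ◂ t)))
      ≡⟨ ∑ᴸ-cong Xs (λ x → *-distribˡ-∑ᴸ (μ x) (Zs k) _) ⟨
    ∑[ a ∈ Xs ] (μ a * ∑[ t ∈ Zs k ] (W t * g (a ◂ t)))
      ≡⟨ ∑W-suc k g g-cong ⟨
    ∑[ z ∈ Zs (suc k) ] (W z * g z)
      ∎
    where
    open ≡-Reasoning
    K : ℚ
    K = ∑[ t ∈ Zs k ] (W t * ∑[ x ∈ Xs ] (μ x * g (x ◂ t)))
  resample (suc k) (suc i) g g-cong = begin
    ∑[ y ∈ Zs (suc k) ] (W y * ∑[ x ∈ Xs ] (μ x * g (y [ suc i ]← x)))
      ≡⟨ ∑W-suc k _ (resampled-cong (suc i) g g-cong) ⟩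
    ∑[ a ∈ Xs ] (μ a * ∑[ t ∈ Zs k ] (W t * ∑[ x ∈ Xs ] (μ x * g ((a ◂ t) [ suc i ]← x))))
      ≡⟨ ∑ᴸ-cong Xs (λ a → cong (μ a *_) (∑ᴸ-cong (Zs k) λ t → cong (W t *_) (∑ᴸ-cong Xs λ x →
           cong (μ x *_) (g-cong λ { zero → refl ; (suc _) → refl })))) ⟩
    ∑[ a ∈ Xs ] (μ a * ∑[ t ∈ Zs k ] (W t * ∑[ x ∈ Xs ] (μ x * g (a ◂ (t [ i ]← x)))))
      ≡⟨ ∑ᴸ-cong Xs (λ a → cong (μ a *_) (resample k i (g ∘ (a ◂_)) (g-cong ∘ ◂-cong a))) ⟩
    ∑[ a ∈ Xs ] (μ a * ∑[ t ∈ Zs k ] (W t * g (a ◂ t)))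
      ≡⟨ ∑W-suc k g g-cong ⟨
    ∑[ z ∈ Zs (suc k) ] (W z * g z)
      ∎
    where
    open ≡-Reasoning
    ◂-cong : ∀ a {t t′ : BlockInput n k} → t ≗ t′ → a ◂ t ≗ a ◂ t′
    ◂-cong a t≗t′ zero    = refl
    ◂-cong a t≗t′ (suc j) = t≗t′ j

  resample-sum : ∀ k (G : Fin k → BlockInput n k → ℚ) → (∀ i → G i Preserves _≗_ ⟶ _≡_) →
                 ∑[ i < k ] ∑[ y ∈ Zs k ] (W y * ∑[ x ∈ Xs ] (μ x * G i (y [ i ]← x)))
                 ≡ ∑[ z ∈ Zs k ] (W z * ∑[ i < k ] G i z)
  resample-sum k G G-cong = begin
    ∑[ i < k ] ∑[ y ∈ Zs k ] (W y * ∑[ x ∈ Xs ] (μ x * G i (y [ i ]← x)))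
      ≡⟨ sum-cong-≗ {k} (λ i → resample k i (G i) (G-cong i)) ⟩
    ∑[ i < k ] ∑[ z ∈ Zs k ] (W z * G i z)
      ≡⟨ ∑ᴸ-sum-comm (Zs k) (λ i z → W z * G i z) ⟨
    ∑[ z ∈ Zs k ] ∑[ i < k ] (W z * G i z)
      ≡⟨ ∑ᴸ-cong (Zs k) (λ z → *-distribˡ-sum (W z) (λ i → G i z)) ⟨
    ∑[ z ∈ Zs k ] (W z * ∑[ i < k ] G i z)
      ∎
    where open ≡-Reasoning

isError : DecidableEquality O → Maybe O → O → Bool
isError _≟_ nothing   o = false
isError _≟_ (just o′) o = not (does (o′ ≟ o))

aborts≡is-nothing : ∀ (A : QueryAlg I O) x → aborts A x ≡ is-nothing (run A x)
aborts≡is-nothing A x with run A x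
... | nothing = refl
... | just _  = refl

errs≡isError : ∀ (_≟_ : DecidableEquality O) (A : QueryAlg I O) x o → errs _≟_ A x o ≡ isError _≟_ (run A x) o
errs≡isError _≟_ A x o with run A x
... | nothing = refl
... | just _  = refl

run-cong : ∀ (A : QueryAlg I O) {x x′ : I → Bool} → x ≗ x′ → run A x ≡ run A x′
run-cong (leaf o)        x≗x′ = refl
run-cong (query i t₀ t₁) {x} {x′} x≗x′ rewrite x≗x′ i with x′ i
... | true  = run-cong t₁ x≗x′
... | false = run-cong t₀ x≗x′

blockQueries : ∀ {k} → Fin k → QueryAlg (Fin k × J) O → (Fin k × J → Bool) → ℕ
blockQueries i (leaf _)              e = 0
blockQueries i (query (j , b) t₀ t₁) e =
  (if does (j Fin.≟ i) then 1 else 0) ℕ.+ (if e (j , b) then blockQueries i t₁ e else blockQueries i t₀ e)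

blockQueries-cong : ∀ {k} (i : Fin k) (A : QueryAlg (Fin k × J) O) {e e′} → e ≗ e′ →
                    blockQueries i A e ≡ blockQueries i A e′
blockQueries-cong i (leaf o)        e≗e′ = refl
blockQueries-cong i (query p t₀ t₁) {e} {e′} e≗e′ rewrite e≗e′ p with e′ p
... | true  = cong (_ ℕ.+_) (blockQueries-cong i t₁ e≗e′)
... | false = cong (_ ℕ.+_) (blockQueries-cong i t₀ e≗e′)

sum-indicator : ∀ {k} (j : Fin k) → ∑[ i < k ] fromℕ (if does (j Fin.≟ i) then 1 else 0) ≡ 1ℚ
sum-indicator {suc k} zero    = trans (cong (_+_ 1ℚ) (sum-replicate-zero k)) (ℚ.+-identityʳ 1ℚ)
sum-indicator {suc k} (suc j) = trans (ℚ.+-identityˡ _) (sum-indicator j)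

sum-indicator-+ : ∀ {k} (j : Fin k) (f : Fin k → ℕ) m → ∑[ i < k ] fromℕ (f i) ≡ fromℕ m →
                  ∑[ i < k ] fromℕ ((if does (j Fin.≟ i) then 1 else 0) ℕ.+ f i) ≡ fromℕ (suc m)
sum-indicator-+ {k} j f m ∑f≡m = begin
  ∑[ i < k ] fromℕ (δ i ℕ.+ f i)                    ≡⟨ sum-cong-≗ {k} (λ i → fromℕ-homo-+ (δ i) (f i)) ⟩
  ∑[ i < k ] (fromℕ (δ i) + fromℕ (f i))            ≡⟨ ∑-distrib-+ (fromℕ ∘ δ) (fromℕ ∘ f) ⟩
  ∑[ i < k ] fromℕ (δ i) + ∑[ i < k ] fromℕ (f i)   ≡⟨ cong₂ _+_ (sum-indicator j) ∑f≡m ⟩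
  1ℚ + fromℕ m                                      ≡⟨ fromℕ-suc m ⟨
  fromℕ (suc m)                                     ∎
  where
  open ≡-Reasoning
  δ : Fin k → ℕ
  δ i = if does (j Fin.≟ i) then 1 else 0

sum-blockQueries : ∀ {k} (A : QueryAlg (Fin k × J) O) e →
                   ∑[ i < k ] fromℕ (blockQueries i A e) ≡ fromℕ (queries A e)
sum-blockQueries {k = k} (leaf o)              e = sum-replicate-zero k
sum-blockQueries {k = k} (query (j , b) t₀ t₁) e with e (j , b)
... | true  = sum-indicator-+ j (λ i → blockQueries i t₁ e) (queries t₁ e) (sum-blockQueries t₁ e)
... | false = sum-indicator-+ j (λ i → blockQueries i t₀ e) (queries t₀ e) (sum-blockQueries t₀ e)

[1+T]*exceeding≤queries : ∀ {k} T (A : QueryAlg (Fin k × J) O) e →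
                          fromℕ (suc T) * ∑[ i < k ] 𝟙 (T ℕ.<ᵇ blockQueries i A e) ≤ fromℕ (queries A e)
[1+T]*exceeding≤queries {k = k} T A e = begin
  fromℕ (suc T) * ∑[ i < k ] 𝟙 (T ℕ.<ᵇ blockQueries i A e)
    ≡⟨ *-distribˡ-sum (fromℕ (suc T)) (λ i → 𝟙 (T ℕ.<ᵇ blockQueries i A e)) ⟩
  ∑[ i < k ] (fromℕ (suc T) * 𝟙 (T ℕ.<ᵇ blockQueries i A e))
    ≤⟨ sum-mono-≤ (λ i → [1+T]*𝟙≤ (T ℕ.<? blockQueries i A e)) ⟩
  ∑[ i < k ] fromℕ (blockQueries i A e)
    ≡⟨ sum-blockQueries A e ⟩
  fromℕ (queries A e)
    ∎
  where
  open ℚ.≤-Reasoning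
  [1+T]*𝟙≤ : ∀ {m} (T<?m : Dec (T ℕ.< m)) → fromℕ (suc T) * 𝟙 (does T<?m) ≤ fromℕ m
  [1+T]*𝟙≤ {m} (yes T<m) = subst (_≤ fromℕ m) (sym (ℚ.*-identityʳ (fromℕ (suc T)))) (fromℕ-mono-≤ T<m)
  [1+T]*𝟙≤ {m} (no _)    = subst (_≤ fromℕ m) (sym (ℚ.*-zeroʳ (fromℕ (suc T)))) (fromℕ-nonNeg m)

-- Embedding one instance into k instances

_≟ᵛ_ : ∀ {k} → DecidableEquality (Vec Bool k)
_≟ᵛ_ = VecP.≡-dec BoolP._≟_

-- v ≡ w [ i ]≔ lookup v i says that v agrees with w outside coordinate i.
readout : ∀ {k} → Fin k → Vec Bool k → Vec Bool k → Maybe Bool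
readout i w v = if does (v ≟ᵛ (w [ i ]≔ lookup v i)) then just (lookup v i) else nothing

readout-[]≔ : ∀ {k} (i : Fin k) w a v → readout i (w [ i ]≔ a) v ≡ readout i w v
readout-[]≔ i w a v =
  cong (λ u → if does (v ≟ᵛ u) then just (lookup v i) else nothing) (VecP.[]≔-idempotent w i)

readout-self : ∀ {k} (i : Fin k) v → readout i v v ≡ just (lookup v i)
readout-self i v rewrite VecP.[]≔-lookup v i | dec-true (v ≟ᵛ v) refl = refl

readout-aborts : ∀ {k} (i : Fin k) u v → 𝟙 (is-nothing (readout i u v)) ≤ 𝟙 (not (does (v ≟ᵛ u)))
readout-aborts i u v with v ≟ᵛ u
... | yes refl rewrite readout-self i v = ℚ.≤-refl
... | no _     = 𝟙-≤1 (is-nothing (readout i u v))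

misreads : ∀ {k} → Fin k → Vec Bool k → Vec Bool k → Bool
misreads i u v = isError BoolP._≟_ (readout i u v) (lookup u i)

private
  head-agrees : ∀ c a → 𝟙 (isError BoolP._≟_ (if c then just a else nothing) a) ≡ 0ℚ
  head-agrees false _     = refl
  head-agrees true  false = refl
  head-agrees true  true  = refl

  zero-head : ∀ {x s r} → x ≡ 0ℚ → s ≤ r → x + s ≤ r
  zero-head {s = s} refl s≤r = subst (_≤ _) (sym (ℚ.+-identityˡ s)) s≤r

  only-head : ∀ {x} k → x ≤ 1ℚ → x + ∑[ i < k ] 0ℚ ≤ 1ℚ
  only-head {x} k x≤1 = subst (_≤ 1ℚ) (sym (trans (cong (_+_ x) (sum-replicate-zero k)) (ℚ.+-identityʳ x))) x≤1

-- A misread at i needs v to differ from u exactly at i, so it happens for at most one i.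
misreads-sum : ∀ {k} (u v : Vec Bool k) → ∑[ i < k ] 𝟙 (misreads i u v) ≤ 𝟙 (not (does (v ≟ᵛ u)))
misreads-sum         []          []          = ℚ.≤-refl
misreads-sum         (false ∷ u) (false ∷ v) = zero-head (head-agrees (does (v ≟ᵛ u)) false) (misreads-sum u v)
misreads-sum         (true  ∷ u) (true  ∷ v) = zero-head (head-agrees (does (v ≟ᵛ u)) true) (misreads-sum u v)
misreads-sum {suc k} (false ∷ u) (true  ∷ v) = only-head k (𝟙-≤1 (misreads zero (false ∷ u) (true ∷ v)))
misreads-sum {suc k} (true  ∷ u) (false ∷ v) = only-head k (𝟙-≤1 (misreads zero (true ∷ u) (false ∷ v)))

aborts-or-exceeds : ∀ {k} c r (u : Vec Bool k) i →
                    𝟙 (is-nothing (if c then nothing else r >>= readout i u))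
                    ≤ 𝟙 (is-nothing r ∨ isError _≟ᵛ_ r u) + 𝟙 c
aborts-or-exceeds true  r        u i =
  subst (_≤ 𝟙 fails + 1ℚ) (ℚ.+-identityˡ 1ℚ) (ℚ.+-monoˡ-≤ 1ℚ (𝟙-nonNeg fails))
  where
  fails : Bool
  fails = is-nothing r ∨ isError _≟ᵛ_ r u
aborts-or-exceeds false nothing  u i = ℚ.≤-reflexive (sym (ℚ.+-identityʳ 1ℚ))
aborts-or-exceeds false (just v) u i = subst (𝟙 (is-nothing (readout i u v)) ≤_)
  (sym (ℚ.+-identityʳ (𝟙 (not (does (v ≟ᵛ u)))))) (readout-aborts i u v)

misreads-or-exceeds : ∀ {k} (c : Fin k → Bool) r (u : Vec Bool k) →
                      ∑[ i < k ] 𝟙 (isError BoolP._≟_ (if c i then nothing else r >>= readout i u) (lookup u i))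
                      ≤ 𝟙 (isError _≟ᵛ_ r u)
misreads-or-exceeds {k} c r u = ℚ.≤-trans (sum-mono-≤ (λ i → skip (c i))) (misreads-of r)
  where
  skip : ∀ {i} b → 𝟙 (isError BoolP._≟_ (if b then nothing else r >>= readout i u) (lookup u i))
                   ≤ 𝟙 (isError BoolP._≟_ (r >>= readout i u) (lookup u i))
  skip {i} true  = 𝟙-nonNeg (isError BoolP._≟_ (r >>= readout i u) (lookup u i))
  skip     false = ℚ.≤-refl
  misreads-of : ∀ r → ∑[ i < k ] 𝟙 (isError BoolP._≟_ (r >>= readout i u) (lookup u i))
                      ≤ 𝟙 (isError _≟ᵛ_ r u)
  misreads-of nothing  = ℚ.≤-reflexive (sum-replicate-zero k)
  misreads-of (just v) = misreads-sum u v

encodeBlocks-cong : ∀ {n k} {z z′ : BlockInput n k} → z ≗ z′ → encodeBlocks z ≗ encodeBlocks z′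
encodeBlocks-cong z≗z′ (j , b) = cong (_$ b) (z≗z′ j)

power-[]← : ∀ {n k} (f : Input n → Bool) (y : BlockInput n k) i x →
            power k f (y [ i ]← x) ≡ power k f y [ i ]≔ f x
power-[]← f y zero    x = refl
power-[]← f y (suc i) x = cong (f (y zero) ∷_) (power-[]← f (y ∘ suc) i x)

module _ {n k : ℕ} where

  BlockAlg : Set
  BlockAlg = QueryAlg (Fin k × Fin n) (Vec Bool k)

  -- The paper's B_{i,y} with budget T for block i, where w plays the role of f^k(y).
  embed : Fin k → BlockInput n k → Vec Bool k → ℕ → BlockAlg → QueryAlg (Fin n) Bool
  embed i y w T       (leaf o)              = leaf (o >>= readout i w)
  embed i y w T       (query (j , b) t₀ t₁) with j Fin.≟ i
  embed i y w zero    (query (j , b) t₀ t₁) | yes _ = leaf nothing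
  embed i y w (suc T) (query (j , b) t₀ t₁) | yes _ = query b (embed i y w T t₀) (embed i y w T t₁)
  embed i y w T       (query (j , b) t₀ t₁) | no _  = if y j b then embed i y w T t₁ else embed i y w T t₀

  embed-queries : ∀ i y w T (A : BlockAlg) x → queries (embed i y w T A) x ℕ.≤ T
  embed-queries i y w T       (leaf o)              x = ℕ.z≤n
  embed-queries i y w T       (query (j , b) t₀ t₁) x with j Fin.≟ i
  embed-queries i y w zero    (query (j , b) t₀ t₁) x | yes _ = ℕ.z≤n
  embed-queries i y w (suc T) (query (j , b) t₀ t₁) x | yes _ with x b
  ... | true  = ℕ.s≤s (embed-queries i y w T t₁ x)
  ... | false = ℕ.s≤s (embed-queries i y w T t₀ x)
  embed-queries i y w T       (query (j , b) t₀ t₁) x | no _ with y j b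
  ... | true  = embed-queries i y w T t₁ x
  ... | false = embed-queries i y w T t₀ x

  embed-run : ∀ i y w T (A : BlockAlg) x → let e = encodeBlocks (y [ i ]← x) in
              run (embed i y w T A) x ≡ (if T ℕ.<ᵇ blockQueries i A e then nothing else run A e >>= readout i w)
  embed-run i y w T       (leaf o)              x = refl
  embed-run i y w T       (query (j , b) t₀ t₁) x with j Fin.≟ i
  embed-run i y w zero    (query (j , b) t₀ t₁) x | yes refl = refl
  embed-run i y w (suc T) (query (j , b) t₀ t₁) x | yes refl
    rewrite cong (_$ b) (VecF.updateAt-updates i {const x} y) with x b
  ... | true  = embed-run i y w T t₁ x
  ... | false = embed-run i y w T t₀ x
  embed-run i y w T       (query (j , b) t₀ t₁) x | no j≢i
    rewrite cong (_$ b) (VecF.updateAt-minimal j i {const x} y j≢i) with y j b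
  ... | true  = embed-run i y w T t₁ x
  ... | false = embed-run i y w T t₀ x

  -- The answer of B_{i,y} on x, as a function of z = y [ i ]← x alone (see embed-outcome).
  outcome : (Input n → Bool) → Fin k → ℕ → BlockAlg → BlockInput n k → Maybe Bool
  outcome f i T A z = if T ℕ.<ᵇ blockQueries i A e then nothing else run A e >>= readout i (power k f z)
    where
    e : Fin k × Fin n → Bool
    e = encodeBlocks z

  embed-outcome : ∀ f i y T (A : BlockAlg) x → run (embed i y (power k f y) T A) x ≡ outcome f i T A (y [ i ]← x)
  embed-outcome f i y T A x = trans (embed-run i y w T A x)
    (cong (λ r → if T ℕ.<ᵇ blockQueries i A e then nothing else r) (begin
      (run A e >>= readout i w)                ≡⟨ >>=-readout-[]≔ (run A e) ⟨
      (run A e >>= readout i (w [ i ]≔ f x))   ≡⟨ cong (λ u → run A e >>= readout i u) (power-[]← f y i x) ⟨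
      (run A e >>= readout i (power k f z))    ∎))
    where
    open ≡-Reasoning
    w : Vec Bool k
    w = power k f y
    z : BlockInput n k
    z = y [ i ]← x
    e : Fin k × Fin n → Bool
    e = encodeBlocks z
    >>=-readout-[]≔ : ∀ r → (r >>= readout i (w [ i ]≔ f x)) ≡ (r >>= readout i w)
    >>=-readout-[]≔ nothing  = refl
    >>=-readout-[]≔ (just v) = readout-[]≔ i w (f x) v

  outcome-cong : ∀ f i T (A : BlockAlg) → outcome f i T A Preserves _≗_ ⟶ _≡_
  outcome-cong f i T A z≗z′ rewrite blockQueries-cong i A (encodeBlocks-cong z≗z′)
    | run-cong A (encodeBlocks-cong z≗z′) | VecP.tabulate-cong (cong f ∘ z≗z′) = refl

  failure : (Input n → Bool) → BlockAlg → BlockInput n k → Bool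
  failure f A z = aborts A (encodeBlocks z) ∨ errs _≟ᵛ_ A (encodeBlocks z) (power k f z)

  outcome-aborts : ∀ f T (A : BlockAlg) z →
                   ∑[ i < k ] 𝟙 (is-nothing (outcome f i T A z))
                   ≤ fromℕ k * 𝟙 (failure f A z) + ∑[ i < k ] 𝟙 (T ℕ.<ᵇ blockQueries i A (encodeBlocks z))
  outcome-aborts f T A z = begin
    ∑[ i < k ] 𝟙 (is-nothing (outcome f i T A z))
      ≤⟨ sum-mono-≤ (λ i → aborts-or-exceeds (exceeds i) (run A e) u i) ⟩
    ∑[ i < k ] (𝟙 fails + 𝟙 (exceeds i))
      ≡⟨ ∑-distrib-+ (λ _ → 𝟙 fails) (𝟙 ∘ exceeds) ⟩
    ∑[ i < k ] 𝟙 fails + ∑[ i < k ] 𝟙 (exceeds i)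
      ≡⟨ cong (_+ ∑[ i < k ] 𝟙 (exceeds i)) (sum-const k (𝟙 fails)) ⟩
    fromℕ k * 𝟙 fails + ∑[ i < k ] 𝟙 (exceeds i)
      ≡⟨ cong (λ b → fromℕ k * 𝟙 b + ∑[ i < k ] 𝟙 (exceeds i))
              (cong₂ _∨_ (aborts≡is-nothing A e) (errs≡isError _≟ᵛ_ A e u)) ⟨
    fromℕ k * 𝟙 (failure f A z) + ∑[ i < k ] 𝟙 (exceeds i)
      ∎
    where
    open ℚ.≤-Reasoning
    e : Fin k × Fin n → Bool
    e = encodeBlocks z
    u : Vec Bool k
    u = power k f z
    exceeds : Fin k → Bool
    exceeds i = T ℕ.<ᵇ blockQueries i A e
    fails : Bool
    fails = is-nothing (run A e) ∨ isError _≟ᵛ_ (run A e) u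

  outcome-errs : ∀ f T (A : BlockAlg) z →
                 ∑[ i < k ] 𝟙 (isError BoolP._≟_ (outcome f i T A z) (lookup (power k f z) i))
                 ≤ 𝟙 (errs _≟ᵛ_ A (encodeBlocks z) (power k f z))
  outcome-errs f T A z =
    subst (∑[ i < k ] 𝟙 (isError BoolP._≟_ (outcome f i T A z) (lookup u i)) ≤_)
          (cong 𝟙 (sym (errs≡isError _≟ᵛ_ A e u)))
          (misreads-or-exceeds (λ i → T ℕ.<ᵇ blockQueries i A e) (run A e) u)
    where
    e : Fin k × Fin n → Bool
    e = encodeBlocks z
    u : Vec Bool k
    u = power k f z

module Reduction {n} (f : Input n → Bool) (μ : Input n → ℚ)
                 (0≤μ : ∀ x → 0ℚ ≤ μ x) (∑μ≡1 : ∑ᴸ (allInputs n) μ ≡ 1ℚ)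
                 (k : ℕ) .{{_ : NonZero k}} (A : BlockAlg {n} {k}) (q : ℕ) (A≤q : QueriesAtMost A q) where

  open ProductDistribution μ ∑μ≡1
  open Averaging (allBlockInputs n k) W (W-nonNeg 0≤μ) k

  private
    Xs : List (Input n)
    Xs = allInputs n
    Zs : List (BlockInput n k)
    Zs = allBlockInputs n k
    K tenth : ℚ
    K = fromℕ k
    tenth = + 1 / 10

  -- T = ⌊10q/k⌋ gives k·T ≤ 10q (the query bound) and 10q < k·(T + 1) (few blocks exceed T).
  T : ℕ
  T = (10 ℕ.* q) ℕ./ k

  kT≤10q : k ℕ.* T ℕ.≤ 10 ℕ.* q
  kT≤10q = subst (ℕ._≤ 10 ℕ.* q) (ℕ.*-comm T k) (ℕ.m/n*n≤m (10 ℕ.* q) k)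

  10q<k[1+T] : 10 ℕ.* q ℕ.< k ℕ.* suc T
  10q<k[1+T] = begin-strict
    10 ℕ.* q                       ≡⟨ ℕ.m≡m%n+[m/n]*n (10 ℕ.* q) k ⟩
    (10 ℕ.* q) ℕ.% k ℕ.+ T ℕ.* k   <⟨ ℕ.+-monoˡ-< (T ℕ.* k) (ℕ.m%n<n (10 ℕ.* q) k) ⟩
    k ℕ.+ T ℕ.* k                  ≡⟨ ℕ.*-comm (suc T) k ⟩
    k ℕ.* suc T                    ∎
    where open ℕ.≤-Reasoning

  tenth*fromℕ[10*m] : ∀ m → tenth * fromℕ (10 ℕ.* m) ≡ fromℕ m
  tenth*fromℕ[10*m] m = begin
    tenth * fromℕ (10 ℕ.* m)       ≡⟨ cong (tenth *_) (fromℕ-homo-* 10 m) ⟩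
    tenth * (fromℕ 10 * fromℕ m)   ≡⟨ ℚ.*-assoc tenth (fromℕ 10) (fromℕ m) ⟨
    1ℚ * fromℕ m                   ≡⟨ ℚ.*-identityˡ (fromℕ m) ⟩
    fromℕ m                        ∎
    where open ≡-Reasoning

  tenth*k*T≤q : tenth * K * fromℕ T ≤ fromℕ q
  tenth*k*T≤q = begin
    tenth * K * fromℕ T        ≡⟨ ℚ.*-assoc tenth K (fromℕ T) ⟩
    tenth * (K * fromℕ T)      ≡⟨ cong (tenth *_) (fromℕ-homo-* k T) ⟨
    tenth * fromℕ (k ℕ.* T)    ≤⟨ *-monoˡ-≤ (from-yes (0ℚ ℚ.≤? tenth)) (fromℕ-mono-≤ kT≤10q) ⟩
    tenth * fromℕ (10 ℕ.* q)   ≡⟨ tenth*fromℕ[10*m] q ⟩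
    fromℕ q                    ∎
    where open ℚ.≤-Reasoning

  budget-rarely-exceeded : ∀ z → ∑[ i < k ] 𝟙 (T ℕ.<ᵇ blockQueries i A (encodeBlocks z)) ≤ K * tenth
  budget-rarely-exceeded z = ℚ.*-cancelˡ-≤-pos [1+T] {{ℚ.positive (fromℕ-pos (suc T))}} (begin
    [1+T] * ∑[ i < k ] 𝟙 (T ℕ.<ᵇ blockQueries i A e)   ≤⟨ [1+T]*exceeding≤queries T A e ⟩
    fromℕ (queries A e)                               ≤⟨ fromℕ-mono-≤ (A≤q e) ⟩
    fromℕ q                                           ≡⟨ tenth*fromℕ[10*m] q ⟨
    tenth * fromℕ (10 ℕ.* q)                          ≤⟨ *-monoˡ-≤ (from-yes (0ℚ ℚ.≤? tenth))
                                                           (fromℕ-mono-≤ (ℕ.<⇒≤ 10q<k[1+T])) ⟩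
    tenth * fromℕ (k ℕ.* suc T)                       ≡⟨ cong (tenth *_) (fromℕ-homo-* k (suc T)) ⟩
    tenth * (K * [1+T])                               ≡⟨ solve 3 (λ t κ s → t :* (κ :* s) := s :* (κ :* t))
                                                               refl tenth K [1+T] ⟩
    [1+T] * (K * tenth)                               ∎)
    where
    open ℚ.≤-Reasoning
    open +-*-Solver
    e : Fin k × Fin n → Bool
    e = encodeBlocks z
    [1+T] : ℚ
    [1+T] = fromℕ (suc T)

  B : Fin k → BlockInput n k → QueryAlg (Fin n) Bool
  B i y = embed i y (power k f y) T A

  abortProb errProb : Fin k → BlockInput n k → ℚ
  abortProb i y = Pr Xs μ (λ x → aborts (B i y) (encode x))
  errProb   i y = Pr Xs μ (λ x → errs BoolP._≟_ (B i y) (encode x) (f x))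

  abortsAt errsAt : Fin k → BlockInput n k → ℚ
  abortsAt i z = 𝟙 (is-nothing (outcome f i T A z))
  errsAt   i z = 𝟙 (isError BoolP._≟_ (outcome f i T A z) (lookup (power k f z) i))

  abortProb-resampled : ∀ i y → abortProb i y ≡ ∑[ x ∈ Xs ] (μ x * abortsAt i (y [ i ]← x))
  abortProb-resampled i y = trans (Pr≡∑ Xs μ _) (∑ᴸ-cong Xs λ x → cong (λ b → μ x * 𝟙 b)
    (trans (aborts≡is-nothing (B i y) x) (cong is-nothing (embed-outcome f i y T A x))))

  errProb-resampled : ∀ i y → errProb i y ≡ ∑[ x ∈ Xs ] (μ x * errsAt i (y [ i ]← x))
  errProb-resampled i y = trans (Pr≡∑ Xs μ _) (∑ᴸ-cong Xs λ x → cong (λ b → μ x * 𝟙 b)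
    (trans (errs≡isError BoolP._≟_ (B i y) x (f x))
           (cong₂ (isError BoolP._≟_) (embed-outcome f i y T A x) (f≡lookup x))))
    where
    f≡lookup : ∀ x → f x ≡ lookup (power k f (y [ i ]← x)) i
    f≡lookup x = trans (sym (VecP.lookup∘update i (power k f y) (f x)))
                       (cong (λ u → lookup u i) (sym (power-[]← f y i x)))

  total-abortProb : total abortProb ≤ K * (Pr Zs W (failure f A) + tenth)
  total-abortProb = begin
    total abortProb
      ≡⟨ sum-cong-≗ {k} (λ i → ∑ᴸ-cong Zs λ y → cong (W y *_) (abortProb-resampled i y)) ⟩
    ∑[ i < k ] ∑[ y ∈ Zs ] (W y * ∑[ x ∈ Xs ] (μ x * abortsAt i (y [ i ]← x)))
      ≡⟨ resample-sum k abortsAt (λ i z≗z′ → cong (𝟙 ∘ is-nothing) (outcome-cong f i T A z≗z′)) ⟩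
    ∑[ z ∈ Zs ] (W z * ∑[ i < k ] abortsAt i z)
      ≤⟨ ∑ᴸ-mono-≤ Zs (λ z → *-monoˡ-≤ (W-nonNeg 0≤μ z) (abortsAt-sum z)) ⟩
    ∑[ z ∈ Zs ] (W z * (K * (𝟙 (failure f A z) + tenth)))
      ≡⟨ ∑W-affine k K tenth (𝟙 ∘ failure f A) ⟩
    K * (∑[ z ∈ Zs ] (W z * 𝟙 (failure f A z)) + tenth)
      ≡⟨ cong (λ p → K * (p + tenth)) (Pr≡∑ Zs W (failure f A)) ⟨
    K * (Pr Zs W (failure f A) + tenth)
      ∎
    where
    open ℚ.≤-Reasoning
    abortsAt-sum : ∀ z → ∑[ i < k ] abortsAt i z ≤ K * (𝟙 (failure f A z) + tenth)
    abortsAt-sum z = begin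
      ∑[ i < k ] abortsAt i z
        ≤⟨ outcome-aborts f T A z ⟩
      K * 𝟙 (failure f A z) + ∑[ i < k ] 𝟙 (T ℕ.<ᵇ blockQueries i A (encodeBlocks z))
        ≤⟨ ℚ.+-monoʳ-≤ (K * 𝟙 (failure f A z)) (budget-rarely-exceeded z) ⟩
      K * 𝟙 (failure f A z) + K * tenth
        ≡⟨ ℚ.*-distribˡ-+ K (𝟙 (failure f A z)) tenth ⟨
      K * (𝟙 (failure f A z) + tenth)
        ∎

  total-errProb : total errProb ≤ Pr Zs W (λ z → errs _≟ᵛ_ A (encodeBlocks z) (power k f z))
  total-errProb = begin
    total errProb
      ≡⟨ sum-cong-≗ {k} (λ i → ∑ᴸ-cong Zs λ y → cong (W y *_) (errProb-resampled i y)) ⟩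
    ∑[ i < k ] ∑[ y ∈ Zs ] (W y * ∑[ x ∈ Xs ] (μ x * errsAt i (y [ i ]← x)))
      ≡⟨ resample-sum k errsAt errsAt-cong ⟩
    ∑[ z ∈ Zs ] (W z * ∑[ i < k ] errsAt i z)
      ≤⟨ ∑ᴸ-mono-≤ Zs (λ z → *-monoˡ-≤ (W-nonNeg 0≤μ z) (outcome-errs f T A z)) ⟩
    ∑[ z ∈ Zs ] (W z * 𝟙 (errs _≟ᵛ_ A (encodeBlocks z) (power k f z)))
      ≡⟨ Pr≡∑ Zs W _ ⟨
    Pr Zs W (λ z → errs _≟ᵛ_ A (encodeBlocks z) (power k f z))
      ∎
    where
    open ℚ.≤-Reasoning
    errsAt-cong : ∀ i → errsAt i Preserves _≗_ ⟶ _≡_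
    errsAt-cong i z≗z′ = cong₂ (λ r b → 𝟙 (isError BoolP._≟_ r b))
      (outcome-cong f i T A z≗z′) (cong (λ u → lookup u i) (VecP.tabulate-cong (cong f ∘ z≗z′)))

  reduction : ∀ {δ ε} → 0ℚ ≤ ε → δ + ε + tenth ≤ + 3 / 20 →
              Solves _≟ᵛ_ Zs encodeBlocks (power k f) W δ ε A →
              Σ (QueryAlg (Fin n) Bool) λ B′ → Σ ℕ λ q′ → QueriesAtMost B′ q′ ×
                Solves BoolP._≟_ Xs encode f μ (+ 1 / 3) (+ 2 / 1 * ε * (+ 1 / k)) B′ ×
                (tenth * K * fromℕ q′ ≤ fromℕ q)
  reduction {δ} {ε} 0≤ε δ+ε+tenth≤ (aborts≤δ , errs≤ε) =
    let i , y , B-solves = averaging (∑W≡1 k) (λ i y → Pr-nonNeg Xs 0≤μ _) (λ i y → Pr-nonNeg Xs 0≤μ _)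
                             0≤ε total-abortProb≤ (ℚ.≤-trans total-errProb errs≤ε)
    in  B i y , T , embed-queries i y (power k f y) T A , B-solves , tenth*k*T≤q
    where
    open ℚ.≤-Reasoning
    total-abortProb≤ : total abortProb ≤ K * (+ 3 / 20)
    total-abortProb≤ = begin
      total abortProb
        ≤⟨ total-abortProb ⟩
      K * (Pr Zs W (failure f A) + tenth)
        ≤⟨ *-monoˡ-≤ (fromℕ-nonNeg k) (ℚ.+-monoˡ-≤ tenth
             (ℚ.≤-trans (Pr-∨ Zs (W-nonNeg 0≤μ) _ _) (ℚ.+-mono-≤ aborts≤δ errs≤ε))) ⟩
      K * (δ + ε + tenth)
        ≤⟨ *-monoˡ-≤ (fromℕ-nonNeg k) δ+ε+tenth≤ ⟩
      K * (+ 3 / 20)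
        ∎

lemma1p5 : Σ ℚ λ c → Σ ℚ λ c' → (0ℚ < c) × (0ℚ < c') ×
  ((n : ℕ) → 1 ℕ.≤ n → (f : Input n → Bool) → (μ : Input n → ℚ) →
   IsDistribution (allInputs n) μ →
   (k : ℕ) → .{{_ : NonZero k}} → (δ ε : ℚ) →
   0ℚ ≤ δ → δ ≤ + 1 / 40 → 0ℚ ≤ ε → ε ≤ + 1 / 40 →
   -- every algorithm for f^k under μ^k with parameters (δ,ε) making at most q queries
   (A : QueryAlg (Fin k × Fin n) (Vec Bool k)) → (q : ℕ) → QueriesAtMost A q →
   Solves (VecP.≡-dec BoolP._≟_) (allBlockInputs n k) encodeBlocks (power k f) (productDist k μ) δ ε A →
   -- yields an algorithm for f under μ with parameters (1/3, cε/k) making q' queries, c'·k·q' ≤ q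
   Σ (QueryAlg (Fin n) Bool) λ B → Σ ℕ λ q' → QueriesAtMost B q' ×
     Solves BoolP._≟_ (allInputs n) encode f μ (+ 1 / 3) (c * ε * (+ 1 / k)) B ×
     (c' * (+ k / 1) * (+ q' / 1) ≤ + q / 1))
lemma1p5 = + 2 / 1 , + 1 / 10 , ℚ.positive⁻¹ (+ 2 / 1) , ℚ.positive⁻¹ (+ 1 / 10) ,
  λ n _ f μ (0≤μ , ∑μ≡1) k δ ε _ δ≤1/40 0≤ε ε≤1/40 A q A≤q →
    Reduction.reduction f μ 0≤μ ∑μ≡1 k A q A≤q 0≤ε
      (ℚ.+-monoˡ-≤ (+ 1 / 10) (ℚ.+-mono-≤ δ≤1/40 ε≤1/40))
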